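{- If $P:\mathcal{C}^{op}\to\mathbf{InfSL}$ is an intensional hyper tripos, then its extensional collapse $X(P):\mathcal{X}_P^{op}\to\mathbf{InfSL}$ is a hyper tripos.
   Context: A primary doctrine is a functor $P:\mathcal{C}^{op}\to\mathbf{InfSL}$, $\mathcal{C}$ with finite products, $\mathbf{InfSL}$ the category of inf-semilattices and meet-preserving maps; $P_f=P(f)$, $\top_A$ the top of $P(A)$. $P$ is elementary if for each $A$ there is $\delta_A\in P(A\times A)$ such that for every $X$ the map $\alpha\mapsto P_{\langle pr_1,pr_2\rangle}(\alpha)\wedge P_{\langle pr_2,pr_3\rangle}(\delta_A)$, $P(X\times A)\to P(X\times A\times A)$, is left adjoint to $P_{\langle pr_1,pr_2,pr_2\rangle}$. $P$ is existential if each $P_{pr}$ along a product projection has a left adjoint satisfying Beck–Chevalley and Frobenius reciprocity. $P$ has comprehensive diagonals if for $f,g:X\to A$: $f=g$ iff $\top_X=P_{\langle f,g\rangle}(\delta_A)$. Full weak comprehension: for each $\alpha\in P(A)$ an arrow $\{\alpha\}:X\to A$ with $\top_X=P_{\{\alpha\}}(\alpha)$ through which every $f:Y\to A$ with $\top_Y\le P_f(\alpha)$ factors (not necessarily uniquely), with $\alpha\le\beta$ iff $\top_X\le P_{\{\alpha\}}(\beta)$. A weak predicate classifier is an object $\Omega$ with $\in\ \in P(\Omega)$ such that each $\phi\in P(A)$ equals $P_\chi(\in)$ for some $\chi:A\to\Omega$. A category $\mathcal{D}$ is weakly cartesian weakly closed if for all objects $X,Y$ there are an object $W$, a weak product $S$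 of $X$ and $W$ and an arrow $ev:S\to Y$ such that for every $C$, every weak product $T$ of $X$ and $C$ and every $k:T\to Y$ there is $k':C\to W$ with $ev\circ h=k$ for an arrow $h:T\to S$ induced from the projection $T\to X$ and $k'$ composed with the projection $T\to C$. A category is slice-wise weakly cartesian closed if it has weak pullbacks and each slice (weak products being weak pullbacks) is weakly cartesian weakly closed. Finite coproducts are distributive if $(A\times B)+(A\times C)\to A\times(B+C)$ is always an isomorphism. An intensional hyper tripos is an elementary existential doctrine with a weak predicate classifier and full weak comprehension whose base has weak pullbacks, is slice-wise weakly cartesian closed and has finite distributive coproducts; a hyper tripos is an intensional hyper tripos with comprehensive diagonals. The extensional collapse of an elementary doctrine $P$: $\mathcal{X}_P$ has the objects of $\mathcal{C}$; an arrow $A\to B$ is an equivalence class $[f]$ of arrows $f:A\to B$ of $\mathcal{C}$ with $\delta_A\le P_{f\times f}(\delta_B)$, where $f$ and $f'$ are identified when $\delta_A\le P_{f\times f'}(\delta_B)$; composition and identities are induced from $\mathcal{C}$. $X(P)(A)=P(A)$ and $X(P)_{[f]}=P_f$. -}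

module Defs where

open import Level using (Level) renaming (suc to lsuc)
open import Data.Product using (Σ; _×_; _,_; proj₁; proj₂)
open import Function.Bundles using (_⇔_)

-- Categories, presented with hom-setoids (needed for the quotient
-- arrows of the extensional collapse).

record CatData (ℓ : Level) : Set (lsuc ℓ) where
  infixr 9 _∘_
  infix 4 _≈_
  field
    Obj : Set ℓ
    Hom : Obj → Obj → Set ℓ
    _≈_ : ∀ {A B} → Hom A B → Hom A B → Set ℓ
    id  : ∀ {A} → Hom A A
    _∘_ : ∀ {A B C} → Hom B C → Hom A B → Hom A C

record IsCategory {ℓ} (C : CatData ℓ) : Set ℓ where
  open CatData C
  field
    ≈-refl    : ∀ {A B} {f : Hom A B} → f ≈ f
    ≈-sym     : ∀ {A B} {f g : Hom A B} → f ≈ g → g ≈ f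
    ≈-trans   : ∀ {A B} {f g h : Hom A B} → f ≈ g → g ≈ h → f ≈ h
    ∘-resp    : ∀ {A B D} {f f' : Hom B D} {g g' : Hom A B} →
                f ≈ f' → g ≈ g' → f ∘ g ≈ f' ∘ g'
    identityˡ : ∀ {A B} {f : Hom A B} → id ∘ f ≈ f
    identityʳ : ∀ {A B} {f : Hom A B} → f ∘ id ≈ f
    assoc     : ∀ {A B D E} {f : Hom A B} {g : Hom B D} {h : Hom D E} →
                (h ∘ g) ∘ f ≈ h ∘ (g ∘ f)

record Products {ℓ} (C : CatData ℓ) : Set ℓ where
  open CatData C
  infixr 7 _×ₒ_
  field
    𝟙        : Obj
    !        : ∀ {A} → Hom A 𝟙
    !-unique : ∀ {A} (f : Hom A 𝟙) → f ≈ !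
    _×ₒ_     : Obj → Obj → Obj
    π₁       : ∀ {A B} → Hom (A ×ₒ B) A
    π₂       : ∀ {A B} → Hom (A ×ₒ B) B
    ⟨_,_⟩    : ∀ {X A B} → Hom X A → Hom X B → Hom X (A ×ₒ B)
    β₁       : ∀ {X A B} {f : Hom X A} {g : Hom X B} → π₁ ∘ ⟨ f , g ⟩ ≈ f
    β₂       : ∀ {X A B} {f : Hom X A} {g : Hom X B} → π₂ ∘ ⟨ f , g ⟩ ≈ g
    unique   : ∀ {X A B} {f : Hom X A} {g : Hom X B} {h : Hom X (A ×ₒ B)} →
               π₁ ∘ h ≈ f → π₂ ∘ h ≈ g → h ≈ ⟨ f , g ⟩

  _⊠_ : ∀ {A B A' B'} → Hom A A' → Hom B B' → Hom (A ×ₒ B) (A' ×ₒ B')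
  f ⊠ g = ⟨ f ∘ π₁ , g ∘ π₂ ⟩

record Coproducts {ℓ} (C : CatData ℓ) : Set ℓ where
  open CatData C
  infixr 6 _+ₒ_
  field
    𝟘        : Obj
    ¡        : ∀ {A} → Hom 𝟘 A
    ¡-unique : ∀ {A} (f : Hom 𝟘 A) → f ≈ ¡
    _+ₒ_     : Obj → Obj → Obj
    ι₁       : ∀ {A B} → Hom A (A +ₒ B)
    ι₂       : ∀ {A B} → Hom B (A +ₒ B)
    [_,_]    : ∀ {A B X} → Hom A X → Hom B X → Hom (A +ₒ B) X
    γ₁       : ∀ {A B X} {f : Hom A X} {g : Hom B X} → [ f , g ] ∘ ι₁ ≈ f
    γ₂       : ∀ {A B X} {f : Hom A X} {g : Hom B X} → [ f , g ] ∘ ι₂ ≈ g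
    unique   : ∀ {A B X} {f : Hom A X} {g : Hom B X} {h : Hom (A +ₒ B) X} →
               h ∘ ι₁ ≈ f → h ∘ ι₂ ≈ g → h ≈ [ f , g ]

-- Data of a functor P : C^op → InfSL.  Each P(A) is a meet-semilattice
-- with top presented as a preorder; its equality is ≤ in both directions.

record PredData {ℓ} (C : CatData ℓ) : Set (lsuc ℓ) where
  open CatData C
  infix 4 _≤_ _≈ₚ_
  infixr 6 _∧_
  field
    P   : Obj → Set ℓ
    _≤_ : ∀ {A} → P A → P A → Set ℓ
    ⊤   : ∀ {A} → P A
    _∧_ : ∀ {A} → P A → P A → P A
    re  : ∀ {A B} → Hom A B → P B → P A

  _≈ₚ_ : ∀ {A} → P A → P A → Set ℓ
  x ≈ₚ y = (x ≤ y) × (y ≤ x)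

record IsDoctrine {ℓ} (C : CatData ℓ) (Pd : PredData C) : Set ℓ where
  open CatData C
  open PredData Pd
  field
    isCategory : IsCategory C
    ≤-refl  : ∀ {A} {x : P A} → x ≤ x
    ≤-trans : ∀ {A} {x y z : P A} → x ≤ y → y ≤ z → x ≤ z
    ⊤-max   : ∀ {A} {x : P A} → x ≤ ⊤
    ∧-lb₁   : ∀ {A} {x y : P A} → x ∧ y ≤ x
    ∧-lb₂   : ∀ {A} {x y : P A} → x ∧ y ≤ y
    ∧-glb   : ∀ {A} {x y z : P A} → z ≤ x → z ≤ y → z ≤ x ∧ y
    re-mono : ∀ {A B} (f : Hom A B) {x y : P B} → x ≤ y → re f x ≤ re f y
    re-∧    : ∀ {A B} (f : Hom A B) (x y : P B) → re f (x ∧ y) ≈ₚ re f x ∧ re f y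
    re-⊤    : ∀ {A B} (f : Hom A B) → re f ⊤ ≈ₚ ⊤
    re-id   : ∀ {A} (x : P A) → re id x ≈ₚ x
    re-∘    : ∀ {A B D} (f : Hom A B) (g : Hom B D) (x : P D) →
              re (g ∘ f) x ≈ₚ re f (re g x)
    re-resp : ∀ {A B} {f g : Hom A B} → f ≈ g → (x : P B) → re f x ≈ₚ re g x

module _ {ℓ} (C : CatData ℓ) where
  open CatData C

  record IsWeakPullback {X Y I W : Obj} (f : Hom X I) (g : Hom Y I)
                        (p : Hom W X) (q : Hom W Y) : Set ℓ where
    field
      commutes : f ∘ p ≈ g ∘ q
      factor   : ∀ {Z} (a : Hom Z X) (b : Hom Z Y) → f ∘ a ≈ g ∘ b →
                 Σ (Hom Z W) λ h → (p ∘ h ≈ a) × (q ∘ h ≈ b)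

  record WeakPullback {X Y I : Obj} (f : Hom X I) (g : Hom Y I) : Set ℓ where
    field
      obj   : Obj
      p₁    : Hom obj X
      p₂    : Hom obj Y
      isWPB : IsWeakPullback f g p₁ p₂

  HasWeakPullbacks : Set ℓ
  HasWeakPullbacks = ∀ {X Y I} (f : Hom X I) (g : Hom Y I) → WeakPullback f g

  -- Weak exponential in the slice over I of (Y,y) by (X,x); weak products
  -- in the slice are weak pullbacks.
  record SliceWeakExp {X Y I : Obj} (x : Hom X I) (y : Hom Y I) : Set ℓ where
    open WeakPullback
    field
      W        : Obj
      w        : Hom W I
      S        : WeakPullback x w
      ev       : Hom (obj S) Y
      ev-slice : y ∘ ev ≈ x ∘ p₁ S
      curry    : ∀ {D} (c : Hom D I) (T : WeakPullback x c) (k : Hom (obj T) Y) →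
                 y ∘ k ≈ x ∘ p₁ T →
                 Σ (Hom D W) λ k' → (w ∘ k' ≈ c) ×
                   Σ (Hom (obj T) (obj S)) λ h →
                     (p₁ S ∘ h ≈ p₁ T) × (p₂ S ∘ h ≈ k' ∘ p₂ T) × (ev ∘ h ≈ k)

  SliceWiseWCC : Set ℓ
  SliceWiseWCC = HasWeakPullbacks ×
                 (∀ {X Y I} (x : Hom X I) (y : Hom Y I) → SliceWeakExp x y)

  Distributive : Products C → Coproducts C → Set ℓ
  Distributive Pr Co =
    ∀ {A B D} → Σ (Hom (A ×ₒ (B +ₒ D)) ((A ×ₒ B) +ₒ (A ×ₒ D))) λ inv →
      (inv ∘ can {A} {B} {D} ≈ id) × (can ∘ inv ≈ id)
    where
    open Products Pr
    open Coproducts Co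
    can : ∀ {A B D} → Hom ((A ×ₒ B) +ₒ (A ×ₒ D)) (A ×ₒ (B +ₒ D))
    can = [ id ⊠ ι₁ , id ⊠ ι₂ ]

module _ {ℓ} {C : CatData ℓ} (Pr : Products C) (Pd : PredData C) where
  open CatData C
  open Products Pr
  open PredData Pd

  record Elementary : Set ℓ where
    field
      δ   : (A : Obj) → P (A ×ₒ A)
      adj : ∀ {X A} (α : P (X ×ₒ A)) (γ : P ((X ×ₒ A) ×ₒ A)) →
            (re π₁ α ∧ re ⟨ π₂ ∘ π₁ , π₂ ⟩ (δ A) ≤ γ)
              ⇔ (α ≤ re ⟨ ⟨ π₁ , π₂ ⟩ , π₂ ⟩ γ)

  record Existential : Set ℓ where
    field
      ∃₁     : ∀ {A B} → P (A ×ₒ B) → P A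
      adj₁   : ∀ {A B} (β : P (A ×ₒ B)) (α : P A) → (∃₁ β ≤ α) ⇔ (β ≤ re π₁ α)
      BC₁    : ∀ {X A B} (f : Hom X A) (β : P (A ×ₒ B)) →
               ∃₁ (re (f ⊠ id) β) ≈ₚ re f (∃₁ β)
      Frob₁  : ∀ {A B} (α : P A) (β : P (A ×ₒ B)) → ∃₁ (re π₁ α ∧ β) ≈ₚ α ∧ ∃₁ β
      ∃₂     : ∀ {A B} → P (A ×ₒ B) → P B
      adj₂   : ∀ {A B} (β : P (A ×ₒ B)) (α : P B) → (∃₂ β ≤ α) ⇔ (β ≤ re π₂ α)
      BC₂    : ∀ {X A B} (f : Hom X B) (β : P (A ×ₒ B)) →
               ∃₂ (re (id ⊠ f) β) ≈ₚ re f (∃₂ β)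
      Frob₂  : ∀ {A B} (α : P B) (β : P (A ×ₒ B)) → ∃₂ (re π₂ α ∧ β) ≈ₚ α ∧ ∃₂ β

  ComprehensiveDiagonals : ((A : Obj) → P (A ×ₒ A)) → Set ℓ
  ComprehensiveDiagonals δ =
    ∀ {X A} (f g : Hom X A) → (f ≈ g) ⇔ (⊤ ≈ₚ re ⟨ f , g ⟩ (δ A))

  record FullWeakComprehension : Set ℓ where
    field
      cObj    : ∀ {A} → P A → Obj
      cArr    : ∀ {A} (α : P A) → Hom (cObj α) A
      c-top   : ∀ {A} (α : P A) → ⊤ ≈ₚ re (cArr α) α
      c-fact  : ∀ {A} (α : P A) {Y} (f : Hom Y A) → ⊤ ≤ re f α →
                Σ (Hom Y (cObj α)) λ h → cArr α ∘ h ≈ f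
      c-full  : ∀ {A} (α β : P A) → (α ≤ β) ⇔ (⊤ ≤ re (cArr α) β)

  record WeakPredicateClassifier : Set ℓ where
    field
      Ω        : Obj
      ∈        : P Ω
      classify : ∀ {A} (φ : P A) → Σ (Hom A Ω) λ χ → φ ≈ₚ re χ ∈

  record IntensionalHyperTripos : Set ℓ where
    field
      elementary    : Elementary
      existential   : Existential
      classifier    : WeakPredicateClassifier
      comprehension : FullWeakComprehension
      weakPullbacks : HasWeakPullbacks C
      sliceWCC      : SliceWiseWCC C
      coproducts    : Coproducts C
      distributive  : Distributive C Pr coproducts

  record HyperTripos : Set ℓ where
    field
      intensional : IntensionalHyperTripos
      compDiag    : ComprehensiveDiagonals
                      (Elementary.δ (IntensionalHyperTripos.elementary intensional))

module Collapse {ℓ} (C : CatData ℓ) (Pr : Products C) (Pd : PredData C)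
                (isD : IsDoctrine C Pd)
                (δ : (A : CatData.Obj C) → PredData.P Pd (Products._×ₒ_ Pr A A)) where
  open CatData C
  open Products Pr
  open PredData Pd
  open IsDoctrine isD
  open IsCategory isCategory

  private
    ⊠-∘ : ∀ {A B D A' B' D'} {f : Hom A B} {g : Hom B D} {f' : Hom A' B'} {g' : Hom B' D'} →
          (g ⊠ g') ∘ (f ⊠ f') ≈ (g ∘ f) ⊠ (g' ∘ f')
    ⊠-∘ {f = f} {g} {f'} {g'} = unique
      (≈-trans (≈-sym assoc) (≈-trans (∘-resp β₁ ≈-refl)
        (≈-trans assoc (≈-trans (∘-resp ≈-refl β₁) (≈-sym assoc)))))
      (≈-trans (≈-sym assoc) (≈-trans (∘-resp β₂ ≈-refl)
        (≈-trans assoc (≈-trans (∘-resp ≈-refl β₂) (≈-sym assoc)))))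

    id⊠id : ∀ {A B} → id {A} ⊠ id {B} ≈ id
    id⊠id = ≈-sym (unique (≈-trans identityʳ (≈-sym identityˡ))
                          (≈-trans identityʳ (≈-sym identityˡ)))

    L1 : ∀ {A} → δ A ≤ re (id ⊠ id) (δ A)
    L1 {A} = ≤-trans (proj₂ (re-id (δ A))) (proj₂ (re-resp id⊠id (δ A)))

    L2 : ∀ {A B D} {f : Hom A B} {g : Hom B D} →
         δ A ≤ re (f ⊠ f) (δ B) → δ B ≤ re (g ⊠ g) (δ D) →
         δ A ≤ re ((g ∘ f) ⊠ (g ∘ f)) (δ D)
    L2 {D = D} {f} {g} pf pg =
      ≤-trans pf (≤-trans (re-mono (f ⊠ f) pg)
        (≤-trans (proj₂ (re-∘ (f ⊠ f) (g ⊠ g) (δ D)))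
                 (proj₁ (re-resp ⊠-∘ (δ D)))))

  XHom : Obj → Obj → Set ℓ
  XHom A B = Σ (Hom A B) λ f → δ A ≤ re (f ⊠ f) (δ B)

  X≈ : ∀ {A B} → XHom A B → XHom A B → Set ℓ
  X≈ {A} {B} (f , _) (f' , _) = δ A ≤ re (f ⊠ f') (δ B)

  Xid : ∀ {A} → XHom A A
  Xid = id , L1

  X∘ : ∀ {A B D} → XHom B D → XHom A B → XHom A D
  X∘ (g , pg) (f , pf) = g ∘ f , L2 pf pg

  XCat : CatData ℓ
  XCat = record { Obj = Obj ; Hom = XHom ; _≈_ = X≈ ; id = Xid ; _∘_ = X∘ }

  XPred : PredData XCat
  XPred = record { P = P ; _≤_ = _≤_ ; ⊤ = ⊤ ; _∧_ = _∧_ ; re = λ f → re (proj₁ f) }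

{-# OPTIONS --safe #-}
-- In an elementary doctrine, f ≐ g, i.e. ⊤ ≤ P⟨f,g⟩(δ), is a congruence for
-- composition and pairing which every reindexing respects, and δ ≤ P(f×g)(δ)
-- holds exactly when f ≐ g.  So 𝒳_P is 𝒞 with arrows identified up to ≐:
-- products, coproducts, distributivity and the whole doctrine structure of P
-- descend, and diagonals become comprehensive by construction.  Weak limits
-- come from comprehension: the weak pullback of f and g in 𝒳_P is the
-- comprehension of P(f×g)(δ), and comprehending P(x×id)(δ) replaces x : X → I
-- by an arrow x̃ through which every triangle commuting up to ≐ lifts strictly,
-- so weak exponentials of 𝒞 between such replacements serve in 𝒳_P.
module Submission where

open import Data.Product using (Σ; _×_; _,_; proj₁; proj₂)
open import Function.Bundles using (Equivalence; mk⇔)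
open import Defs

module CategoryFacts {ℓ} {C : CatData ℓ} (isC : IsCategory C) where
  open CatData C
  open IsCategory isC

  ∘-resp-≈ˡ : ∀ {A B D} {f f' : Hom B D} {g : Hom A B} → f ≈ f' → f ∘ g ≈ f' ∘ g
  ∘-resp-≈ˡ p = ∘-resp p ≈-refl

  ∘-resp-≈ʳ : ∀ {A B D} {f : Hom B D} {g g' : Hom A B} → g ≈ g' → f ∘ g ≈ f ∘ g'
  ∘-resp-≈ʳ p = ∘-resp ≈-refl p

module ProductFacts {ℓ} {C : CatData ℓ} (isC : IsCategory C) (Pr : Products C) where
  open CatData C
  open IsCategory isC
  open CategoryFacts isC
  open Products Pr

  ⟨⟩-cong₂ : ∀ {X A B} {f f' : Hom X A} {g g' : Hom X B} →
             f ≈ f' → g ≈ g' → ⟨ f , g ⟩ ≈ ⟨ f' , g' ⟩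
  ⟨⟩-cong₂ p q = unique (≈-trans β₁ p) (≈-trans β₂ q)

  ⟨⟩∘ : ∀ {Y X A B} {f : Hom X A} {g : Hom X B} {h : Hom Y X} →
        ⟨ f , g ⟩ ∘ h ≈ ⟨ f ∘ h , g ∘ h ⟩
  ⟨⟩∘ = unique (≈-trans (≈-sym assoc) (∘-resp-≈ˡ β₁))
               (≈-trans (≈-sym assoc) (∘-resp-≈ˡ β₂))

  ⟨⟩-η : ∀ {X A B} {h : Hom X (A ×ₒ B)} → h ≈ ⟨ π₁ ∘ h , π₂ ∘ h ⟩
  ⟨⟩-η = unique ≈-refl ≈-refl

  ⟨π₁,π₂⟩≈id : ∀ {A B} → ⟨ π₁ , π₂ ⟩ ≈ id {A ×ₒ B}
  ⟨π₁,π₂⟩≈id = ≈-sym (unique identityʳ identityʳ)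

  π₁∘-factor : ∀ {Y X A B} {c : Hom X (A ×ₒ B)} {h : Hom Y X} {f : Hom Y A} {g : Hom Y B} →
               c ∘ h ≈ ⟨ f , g ⟩ → (π₁ ∘ c) ∘ h ≈ f
  π₁∘-factor p = ≈-trans assoc (≈-trans (∘-resp-≈ʳ p) β₁)

  π₂∘-factor : ∀ {Y X A B} {c : Hom X (A ×ₒ B)} {h : Hom Y X} {f : Hom Y A} {g : Hom Y B} →
               c ∘ h ≈ ⟨ f , g ⟩ → (π₂ ∘ c) ∘ h ≈ g
  π₂∘-factor p = ≈-trans assoc (≈-trans (∘-resp-≈ʳ p) β₂)

  ∘π₁∘⟨id,⟩ : ∀ {Z A B} {k : Hom Z B} {a : Hom Z A} → (k ∘ π₁) ∘ ⟨ id , a ⟩ ≈ k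
  ∘π₁∘⟨id,⟩ = ≈-trans assoc (≈-trans (∘-resp-≈ʳ β₁) identityʳ)

  swap∘⟨⟩ : ∀ {Z A B} {f : Hom Z A} {g : Hom Z B} → ⟨ π₂ , π₁ ⟩ ∘ ⟨ f , g ⟩ ≈ ⟨ g , f ⟩
  swap∘⟨⟩ = ≈-trans ⟨⟩∘ (⟨⟩-cong₂ β₂ β₁)

  ⊠∘⟨⟩ : ∀ {Z A B A' B'} {f : Hom A A'} {g : Hom B B'} {a : Hom Z A} {b : Hom Z B} →
         (f ⊠ g) ∘ ⟨ a , b ⟩ ≈ ⟨ f ∘ a , g ∘ b ⟩
  ⊠∘⟨⟩ = ≈-trans ⟨⟩∘ (⟨⟩-cong₂ (≈-trans assoc (∘-resp-≈ʳ β₁))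
                                 (≈-trans assoc (∘-resp-≈ʳ β₂)))

  ⊠∘⟨id,id⟩ : ∀ {A A' B'} {f : Hom A A'} {g : Hom A B'} → (f ⊠ g) ∘ ⟨ id , id ⟩ ≈ ⟨ f , g ⟩
  ⊠∘⟨id,id⟩ = ≈-trans ⊠∘⟨⟩ (⟨⟩-cong₂ identityʳ identityʳ)

module CoproductFacts {ℓ} {C : CatData ℓ} (isC : IsCategory C) (Co : Coproducts C) where
  open CatData C
  open IsCategory isC
  open CategoryFacts isC
  open Coproducts Co

  ∘[] : ∀ {A B X Y} {f : Hom A X} {g : Hom B X} {h : Hom X Y} →
        h ∘ [ f , g ] ≈ [ h ∘ f , h ∘ g ]
  ∘[] = unique (≈-trans assoc (∘-resp-≈ʳ γ₁)) (≈-trans assoc (∘-resp-≈ʳ γ₂))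

  []-cong₂ : ∀ {A B X} {f f' : Hom A X} {g g' : Hom B X} →
             f ≈ f' → g ≈ g' → [ f , g ] ≈ [ f' , g' ]
  []-cong₂ p q = unique (≈-trans γ₁ p) (≈-trans γ₂ q)

  [ι₁,ι₂]≈id : ∀ {A B} → [ ι₁ , ι₂ ] ≈ id {A +ₒ B}
  [ι₁,ι₂]≈id = ≈-sym (unique identityˡ identityˡ)

  ∘ι₂-factor : ∀ {A B Y Z} {f : Hom Y Z} {h : Hom (A +ₒ B) Y} {a : Hom A Z} {b : Hom B Z} →
               f ∘ h ≈ [ a , b ] → f ∘ (h ∘ ι₂) ≈ b
  ∘ι₂-factor p = ≈-trans (≈-sym assoc) (≈-trans (∘-resp-≈ˡ p) γ₂)

  -- Cones factor through the first summand; the second one only has to commute.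
  +-weakPullback : ∀ {X Y I V T} {f : Hom X I} {g : Hom Y I}
                   {u₁ : Hom V X} {u₂ : Hom V Y} {n : Hom T X} {t : Hom T Y} →
                   IsWeakPullback C f g u₁ u₂ → f ∘ n ≈ g ∘ t →
                   IsWeakPullback C f g [ u₁ , n ] [ u₂ , t ]
  +-weakPullback w fn≈gt = record
    { commutes = ≈-trans ∘[] (≈-trans ([]-cong₂ commutes fn≈gt) (≈-sym ∘[]))
    ; factor   = λ a b p →
        let (h , u₁h≈a , u₂h≈b) = factor a b p in
        ι₁ ∘ h , ≈-trans (≈-sym assoc) (≈-trans (∘-resp-≈ˡ γ₁) u₁h≈a)
               , ≈-trans (≈-sym assoc) (≈-trans (∘-resp-≈ˡ γ₁) u₂h≈b)
    }
    where open IsWeakPullback w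

module DoctrineFacts {ℓ} {C : CatData ℓ} {Pd : PredData C} (isD : IsDoctrine C Pd) where
  open CatData C
  open PredData Pd
  open IsDoctrine isD
  open IsCategory isCategory

  ∧-mono : ∀ {A} {x y x' y' : P A} → x ≤ x' → y ≤ y' → x ∧ y ≤ x' ∧ y'
  ∧-mono p q = ∧-glb (≤-trans ∧-lb₁ p) (≤-trans ∧-lb₂ q)

  re-∘-≤ : ∀ {A B D} {f : Hom A B} {g : Hom B D} {h : Hom A D} (x : P D) →
           g ∘ f ≈ h → re f (re g x) ≤ re h x
  re-∘-≤ {f = f} {g} x p = ≤-trans (proj₂ (re-∘ f g x)) (proj₁ (re-resp p x))

  re-∘-≥ : ∀ {A B D} {f : Hom A B} {g : Hom B D} {h : Hom A D} (x : P D) →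
           g ∘ f ≈ h → re h x ≤ re f (re g x)
  re-∘-≥ {f = f} {g} x p = ≤-trans (proj₂ (re-resp p x)) (proj₁ (re-∘ f g x))

  re-≈id : ∀ {A} {f : Hom A A} (x : P A) → f ≈ id → re f x ≈ₚ x
  re-≈id x p = ≤-trans (proj₁ (re-resp p x)) (proj₁ (re-id x))
             , ≤-trans (proj₂ (re-id x)) (proj₂ (re-resp p x))

  Holds : ∀ {Z A} → Hom Z A → P A → Set ℓ
  Holds f θ = ⊤ ≤ re f θ

  Holds-resp : ∀ {Z A} {f g : Hom Z A} {θ : P A} → f ≈ g → Holds f θ → Holds g θ
  Holds-resp {θ = θ} p h = ≤-trans h (proj₁ (re-resp p θ))

  re-Holds : ∀ {Z A B} {f : Hom Z A} {g : Hom A B} {h : Hom Z B} {θ : P B} →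
             g ∘ f ≈ h → Holds f (re g θ) → Holds h θ
  re-Holds {θ = θ} p h = ≤-trans h (re-∘-≤ θ p)

  Holds-re : ∀ {Z A B} {f : Hom Z A} {g : Hom A B} {h : Hom Z B} {θ : P B} →
             g ∘ f ≈ h → Holds h θ → Holds f (re g θ)
  Holds-re {θ = θ} p h = ≤-trans h (re-∘-≥ θ p)

  Holds-precomp : ∀ {Y Z A} {f : Hom Z A} {θ : P A} (h : Hom Y Z) →
                  Holds f θ → Holds (f ∘ h) θ
  Holds-precomp h p = re-Holds ≈-refl (≤-trans (proj₂ (re-⊤ h)) (re-mono h p))

module InternalEquality {ℓ} {C : CatData ℓ} {Pr : Products C} {Pd : PredData C}
                        (isD : IsDoctrine C Pd) (E : Elementary Pr Pd) where
  open CatData C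
  open Products Pr
  open PredData Pd
  open IsDoctrine isD
  open IsCategory isCategory
  open ProductFacts isCategory Pr
  open DoctrineFacts isD
  open Elementary E

  infix 4 _≐_
  _≐_ : ∀ {Z A} → Hom Z A → Hom Z A → Set ℓ
  _≐_ {A = A} f g = Holds ⟨ f , g ⟩ (δ A)

  δ-refl : ∀ {X A} → Holds {X ×ₒ A} ⟨ π₂ , π₂ ⟩ (δ A)
  δ-refl {X} {A} = re-Holds kk-diag (Equivalence.to (adj ⊤ _) ∧-lb₂)
    where
    kk-diag : ⟨ π₂ ∘ π₁ , π₂ ⟩ ∘ ⟨ ⟨ π₁ , π₂ ⟩ , π₂ ⟩ ≈ ⟨ π₂ {A = X} {B = A} , π₂ ⟩
    kk-diag = ≈-trans ⟨⟩∘ (⟨⟩-cong₂ (π₂∘-factor β₁) β₂)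

  δ-transport : ∀ {X A} (θ : P (X ×ₒ A)) →
                re π₁ θ ∧ re ⟨ π₂ ∘ π₁ , π₂ ⟩ (δ A) ≤ re ⟨ π₁ ∘ π₁ , π₂ ⟩ θ
  δ-transport θ = Equivalence.from (adj θ _)
    (≤-trans (proj₂ (re-id θ))
             (re-∘-≥ θ (≈-trans ⟨⟩∘ (≈-trans (⟨⟩-cong₂ (π₁∘-factor β₁) β₂) ⟨π₁,π₂⟩≈id))))

  leibniz : ∀ {Z X A} (θ : P (X ×ₒ A)) (e : Hom Z X) (u v : Hom Z A) →
            re ⟨ e , u ⟩ θ ∧ re ⟨ u , v ⟩ (δ A) ≤ re ⟨ e , v ⟩ θ
  leibniz {A = A} θ e u v =
    ≤-trans (∧-mono (re-∘-≥ θ β₁) (re-∘-≥ (δ A) (≈-trans ⟨⟩∘ (⟨⟩-cong₂ (π₂∘-factor β₁) β₂))))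
   (≤-trans (proj₂ (re-∧ m _ _))
   (≤-trans (re-mono m (δ-transport θ))
            (re-∘-≤ θ (≈-trans ⟨⟩∘ (⟨⟩-cong₂ (π₁∘-factor β₁) β₂)))))
    where m = ⟨ ⟨ e , u ⟩ , v ⟩

  ≐-subst : ∀ {Z X A} (θ : P (X ×ₒ A)) {e : Hom Z X} {u v : Hom Z A} →
            Holds ⟨ e , u ⟩ θ → u ≐ v → Holds ⟨ e , v ⟩ θ
  ≐-subst θ p q = ≤-trans (∧-glb p q) (leibniz θ _ _ _)

  ≐-refl : ∀ {Z A} {f : Hom Z A} → f ≐ f
  ≐-refl {f = f} = Holds-resp (≈-trans ⟨⟩∘ (⟨⟩-cong₂ β₂ β₂)) (Holds-precomp ⟨ f , f ⟩ δ-refl)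

  ≐-reflexive : ∀ {Z A} {f g : Hom Z A} → f ≈ g → f ≐ g
  ≐-reflexive p = Holds-resp (⟨⟩-cong₂ ≈-refl p) ≐-refl

  ≐-sym : ∀ {Z A} {f g : Hom Z A} → f ≐ g → g ≐ f
  ≐-sym {A = A} p = re-Holds swap∘⟨⟩ (≐-subst (re ⟨ π₂ , π₁ ⟩ (δ A)) (Holds-re swap∘⟨⟩ ≐-refl) p)

  ≐-trans : ∀ {Z A} {f g h : Hom Z A} → f ≐ g → g ≐ h → f ≐ h
  ≐-trans {A = A} = ≐-subst (δ A)

  ≐-precomp : ∀ {Y Z A} {u v : Hom Z A} (h : Hom Y Z) → u ≐ v → u ∘ h ≐ v ∘ h
  ≐-precomp h p = Holds-resp ⟨⟩∘ (Holds-precomp h p)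

  ≐-postcomp : ∀ {Z A B} (k : Hom A B) {u v : Hom Z A} → u ≐ v → k ∘ u ≐ k ∘ v
  ≐-postcomp {B = B} k p = re-Holds ⊠∘⟨⟩ (≐-subst (re (k ⊠ k) (δ B)) (Holds-re ⊠∘⟨⟩ ≐-refl) p)

  ∘-resp-≐ : ∀ {Z A B} {f f' : Hom A B} {g g' : Hom Z A} → f ≐ f' → g ≐ g' → f ∘ g ≐ f' ∘ g'
  ∘-resp-≐ {f = f} {g' = g'} p q = ≐-trans (≐-postcomp f q) (≐-precomp g' p)

  ⟨⟩-congˡ-≐ : ∀ {Z A B} {f f' : Hom Z A} {g : Hom Z B} → f ≐ f' → ⟨ f , g ⟩ ≐ ⟨ f' , g ⟩
  ⟨⟩-congˡ-≐ {A = A} {B} {f} {g = g} p = re-Holds eq (≐-subst θ (Holds-re eq ≐-refl) p)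
    where
    θ = re ⟨ ⟨ f ∘ π₁ , g ∘ π₁ ⟩ , ⟨ π₂ , g ∘ π₁ ⟩ ⟩ (δ (A ×ₒ B))
    eq : ∀ {a} → ⟨ ⟨ f ∘ π₁ , g ∘ π₁ ⟩ , ⟨ π₂ , g ∘ π₁ ⟩ ⟩ ∘ ⟨ id , a ⟩ ≈ ⟨ ⟨ f , g ⟩ , ⟨ a , g ⟩ ⟩
    eq = ≈-trans ⟨⟩∘ (⟨⟩-cong₂ (≈-trans ⟨⟩∘ (⟨⟩-cong₂ ∘π₁∘⟨id,⟩ ∘π₁∘⟨id,⟩))
                               (≈-trans ⟨⟩∘ (⟨⟩-cong₂ β₂ ∘π₁∘⟨id,⟩)))

  ⟨⟩-congʳ-≐ : ∀ {Z A B} {f : Hom Z A} {g g' : Hom Z B} → g ≐ g' → ⟨ f , g ⟩ ≐ ⟨ f , g' ⟩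
  ⟨⟩-congʳ-≐ {A = A} {B} {f} {g} p = re-Holds eq (≐-subst θ (Holds-re eq ≐-refl) p)
    where
    θ = re ⟨ ⟨ f ∘ π₁ , g ∘ π₁ ⟩ , ⟨ f ∘ π₁ , π₂ ⟩ ⟩ (δ (A ×ₒ B))
    eq : ∀ {b} → ⟨ ⟨ f ∘ π₁ , g ∘ π₁ ⟩ , ⟨ f ∘ π₁ , π₂ ⟩ ⟩ ∘ ⟨ id , b ⟩ ≈ ⟨ ⟨ f , g ⟩ , ⟨ f , b ⟩ ⟩
    eq = ≈-trans ⟨⟩∘ (⟨⟩-cong₂ (≈-trans ⟨⟩∘ (⟨⟩-cong₂ ∘π₁∘⟨id,⟩ ∘π₁∘⟨id,⟩))
                               (≈-trans ⟨⟩∘ (⟨⟩-cong₂ ∘π₁∘⟨id,⟩ β₂)))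

  ⟨⟩-unique-≐ : ∀ {Z A B} {h : Hom Z (A ×ₒ B)} {f : Hom Z A} {g : Hom Z B} →
                π₁ ∘ h ≐ f → π₂ ∘ h ≐ g → h ≐ ⟨ f , g ⟩
  ⟨⟩-unique-≐ p q = ≐-trans (≐-reflexive ⟨⟩-η) (≐-trans (⟨⟩-congˡ-≐ p) (⟨⟩-congʳ-≐ q))

  δ-least : ∀ {A} (φ : P (A ×ₒ A)) → Holds ⟨ id , id ⟩ φ → δ A ≤ φ
  δ-least {A} φ h =
    ≤-trans (∧-glb (≤-trans ⊤-max (Holds-resp diag (Holds-precomp π₁ h)))
                   (proj₂ (re-≈id (δ A) ⟨π₁,π₂⟩≈id)))
   (≤-trans (leibniz φ π₁ π₁ π₂) (proj₁ (re-≈id φ ⟨π₁,π₂⟩≈id)))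
    where
    diag : ⟨ id , id ⟩ ∘ π₁ ≈ ⟨ π₁ , π₁ ⟩
    diag = ≈-trans ⟨⟩∘ (⟨⟩-cong₂ identityˡ identityˡ)

  δ≤⇒≐ : ∀ {A B} {f g : Hom A B} → δ A ≤ re (f ⊠ g) (δ B) → f ≐ g
  δ≤⇒≐ p = re-Holds ⊠∘⟨id,id⟩ (≤-trans (≐-refl {f = id}) (re-mono ⟨ id , id ⟩ p))

  ≐⇒δ≤ : ∀ {A B} {f g : Hom A B} → f ≐ g → δ A ≤ re (f ⊠ g) (δ B)
  ≐⇒δ≤ p = δ-least _ (Holds-re ⊠∘⟨id,id⟩ p)

  ≈⇒δ≤ : ∀ {A B} {f g : Hom A B} → f ≈ g → δ A ≤ re (f ⊠ g) (δ B)
  ≈⇒δ≤ p = ≐⇒δ≤ (≐-reflexive p)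

  re-resp-≐ : ∀ {Z A} {f g : Hom Z A} (x : P A) → f ≐ g → re f x ≤ re g x
  re-resp-≐ {f = f} {g} x p =
    ≤-trans (∧-glb (re-∘-≥ x β₂) (≤-trans ⊤-max p))
   (≤-trans (leibniz (re π₂ x) id f g) (re-∘-≤ x β₂))

  module ≐-Reasoning where
    infix  1 begin_
    infixr 2 _≐⟨_⟩_ _≈⟨_⟩_
    infix  3 _∎

    begin_ : ∀ {Z A} {f g : Hom Z A} → f ≐ g → f ≐ g
    begin p = p

    _≐⟨_⟩_ : ∀ {Z A} (f : Hom Z A) {g h : Hom Z A} → f ≐ g → g ≐ h → f ≐ h
    _ ≐⟨ p ⟩ q = ≐-trans p q

    _≈⟨_⟩_ : ∀ {Z A} (f : Hom Z A) {g h : Hom Z A} → f ≈ g → g ≐ h → f ≐ h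
    _ ≈⟨ p ⟩ q = ≐-trans (≐-reflexive p) q

    _∎ : ∀ {Z A} (f : Hom Z A) → f ≐ f
    _ ∎ = ≐-refl

module ComprehensionFacts {ℓ} {C : CatData ℓ} {Pr : Products C} {Pd : PredData C}
                          (isD : IsDoctrine C Pd) (Cm : FullWeakComprehension Pr Pd)
                          (Co : Coproducts C) where
  open CatData C
  open PredData Pd
  open IsDoctrine isD
  open IsCategory isCategory
  open CoproductFacts isCategory Co
  open Coproducts Co
  open DoctrineFacts isD
  open FullWeakComprehension Cm

  Holds-+ : ∀ {A B} {ψ : P (A +ₒ B)} → Holds ι₁ ψ → Holds ι₂ ψ → Holds id ψ
  Holds-+ {ψ = ψ} h₁ h₂ =
    Holds-resp c∘[m₁,m₂]≈id (Holds-precomp [ proj₁ m₁ , proj₁ m₂ ] (proj₁ (c-top ψ)))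
    where
    m₁ = c-fact ψ ι₁ h₁
    m₂ = c-fact ψ ι₂ h₂
    c∘[m₁,m₂]≈id : cArr ψ ∘ [ proj₁ m₁ , proj₁ m₂ ] ≈ id
    c∘[m₁,m₂]≈id = ≈-trans ∘[] (≈-trans ([]-cong₂ (proj₂ m₁) (proj₂ m₂)) [ι₁,ι₂]≈id)

module InternalWeakPullbacks {ℓ} {C : CatData ℓ} {Pr : Products C} {Pd : PredData C}
                             (isD : IsDoctrine C Pd) (E : Elementary Pr Pd)
                             (Cm : FullWeakComprehension Pr Pd) where
  open CatData C
  open Products Pr
  open PredData Pd
  open IsDoctrine isD
  open IsCategory isCategory
  open CategoryFacts isCategory
  open ProductFacts isCategory Pr
  open DoctrineFacts isD
  open InternalEquality isD E
  open Elementary E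
  open FullWeakComprehension Cm

  record Is≐-WeakPullback {X Y I W : Obj} (f : Hom X I) (g : Hom Y I)
                          (p : Hom W X) (q : Hom W Y) : Set ℓ where
    field
      commutes : f ∘ p ≐ g ∘ q
      factor   : ∀ {Z} (a : Hom Z X) (b : Hom Z Y) → f ∘ a ≐ g ∘ b →
                 Σ (Hom Z W) λ h → (p ∘ h ≈ a) × (q ∘ h ≈ b)

  record ≐-WeakPullback {X Y I : Obj} (f : Hom X I) (g : Hom Y I) : Set ℓ where
    field
      obj   : Obj
      p₁    : Hom obj X
      p₂    : Hom obj Y
      isWPB : Is≐-WeakPullback f g p₁ p₂

  ≐-weakPullback : ∀ {X Y I} (f : Hom X I) (g : Hom Y I) → ≐-WeakPullback f g
  ≐-weakPullback {I = I} f g = record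
    { obj   = cObj ψ
    ; p₁    = π₁ ∘ cArr ψ
    ; p₂    = π₂ ∘ cArr ψ
    ; isWPB = record
      { commutes = re-Holds (≈-trans ⟨⟩∘ (⟨⟩-cong₂ assoc assoc)) (proj₁ (c-top ψ))
      ; factor   = λ a b p →
          let (h , ch≈⟨a,b⟩) = c-fact ψ ⟨ a , b ⟩ (Holds-re ⊠∘⟨⟩ p) in
          h , π₁∘-factor ch≈⟨a,b⟩ , π₂∘-factor ch≈⟨a,b⟩
      }
    }
    where ψ = re (f ⊠ g) (δ I)

  -- x̃ is x made strict: over the object of pairs (a, i) with x a ≐ i, it
  -- returns i.
  record Saturation {X I : Obj} (x : Hom X I) : Set ℓ where
    field
      obj   : Obj
      q     : Hom obj X
      x̃     : Hom obj I
      x∘q≐x̃ : x ∘ q ≐ x̃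
      lift  : ∀ {Z} (a : Hom Z X) (v : Hom Z I) → x ∘ a ≐ v →
              Σ (Hom Z obj) λ n → (q ∘ n ≈ a) × (x̃ ∘ n ≈ v)

  saturation : ∀ {X I} (x : Hom X I) → Saturation x
  saturation x = record
    { obj   = obj
    ; q     = p₁
    ; x̃     = p₂
    ; x∘q≐x̃ = ≐-trans commutes (≐-reflexive identityˡ)
    ; lift  = λ a v p → factor a v (≐-trans p (≐-reflexive (≈-sym identityˡ)))
    }
    where
    open ≐-WeakPullback (≐-weakPullback x id)
    open Is≐-WeakPullback isWPB

  saturation-paste : ∀ {X Y I W} {x : Hom X I} (σ : Saturation x) {g : Hom Y I}
                     {s₁ : Hom W (Saturation.obj σ)} {s₂ : Hom W Y} →
                     IsWeakPullback C (Saturation.x̃ σ) g s₁ s₂ →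
                     Is≐-WeakPullback x g (Saturation.q σ ∘ s₁) s₂
  saturation-paste {x = x} σ {g} {s₁} {s₂} w = record
    { commutes = begin
        x ∘ (q ∘ s₁)  ≈⟨ ≈-sym assoc ⟩
        (x ∘ q) ∘ s₁  ≐⟨ ≐-precomp s₁ x∘q≐x̃ ⟩
        x̃ ∘ s₁        ≈⟨ commutes ⟩
        g ∘ s₂        ∎
    ; factor   = λ a b p →
        let (n , qn≈a , x̃n≈gb) = lift a (g ∘ b) p
            (h , s₁h≈n , s₂h≈b) = factor n b x̃n≈gb
        in h , ≈-trans assoc (≈-trans (∘-resp-≈ʳ s₁h≈n) qn≈a) , s₂h≈b
    }
    where
    open Saturation σ
    open IsWeakPullback w
    open ≐-Reasoning

module Collapsed {ℓ} (C : CatData ℓ) (Pr : Products C) (Pd : PredData C)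
                 (isD : IsDoctrine C Pd) (H : IntensionalHyperTripos Pr Pd) where
  open CatData C
  open Products Pr
  open IsDoctrine isD
  open IsCategory isCategory
  open CategoryFacts isCategory
  open ProductFacts isCategory Pr
  open DoctrineFacts isD
  open IntensionalHyperTripos H
  open Elementary elementary using (δ; adj)
  open FullWeakComprehension comprehension
  open InternalEquality isD elementary
  open InternalWeakPullbacks isD elementary comprehension
  open Collapse C Pr Pd isD δ using (XCat; XPred; XHom; X≈; X∘)
  module Co = Coproducts coproducts
  open Co using (_+ₒ_; ι₁; ι₂; [_,_]; γ₁; γ₂)
  open CoproductFacts isCategory coproducts
  open ComprehensionFacts isD comprehension coproducts

  ⟦_⟧ : ∀ {A B} → Hom A B → XHom A B
  ⟦ f ⟧ = f , ≐⇒δ≤ ≐-refl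

  X-isCategory : IsCategory XCat
  X-isCategory = record
    { ≈-refl    = ≐⇒δ≤ ≐-refl
    ; ≈-sym     = λ p → ≐⇒δ≤ (≐-sym (δ≤⇒≐ p))
    ; ≈-trans   = λ p q → ≐⇒δ≤ (≐-trans (δ≤⇒≐ p) (δ≤⇒≐ q))
    ; ∘-resp    = λ p q → ≐⇒δ≤ (∘-resp-≐ (δ≤⇒≐ p) (δ≤⇒≐ q))
    ; identityˡ = ≈⇒δ≤ identityˡ
    ; identityʳ = ≈⇒δ≤ identityʳ
    ; assoc     = ≈⇒δ≤ assoc
    }

  X-isDoctrine : IsDoctrine XCat XPred
  X-isDoctrine = record
    { isCategory = X-isCategory
    ; ≤-refl  = ≤-refl
    ; ≤-trans = ≤-trans
    ; ⊤-max   = ⊤-max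
    ; ∧-lb₁   = ∧-lb₁
    ; ∧-lb₂   = ∧-lb₂
    ; ∧-glb   = ∧-glb
    ; re-mono = λ f → re-mono (proj₁ f)
    ; re-∧    = λ f → re-∧ (proj₁ f)
    ; re-⊤    = λ f → re-⊤ (proj₁ f)
    ; re-id   = re-id
    ; re-∘    = λ f g → re-∘ (proj₁ f) (proj₁ g)
    ; re-resp = λ p x → re-resp-≐ x (δ≤⇒≐ p) , re-resp-≐ x (≐-sym (δ≤⇒≐ p))
    }

  X-products : Products XCat
  X-products = record
    { 𝟙        = 𝟙
    ; !        = ⟦ ! ⟧
    ; !-unique = λ f → ≈⇒δ≤ (!-unique (proj₁ f))
    ; _×ₒ_     = _×ₒ_
    ; π₁       = ⟦ π₁ ⟧
    ; π₂       = ⟦ π₂ ⟧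
    ; ⟨_,_⟩    = λ f g → ⟦ ⟨ proj₁ f , proj₁ g ⟩ ⟧
    ; β₁       = ≈⇒δ≤ β₁
    ; β₂       = ≈⇒δ≤ β₂
    ; unique   = λ p q → ≐⇒δ≤ (⟨⟩-unique-≐ (δ≤⇒≐ p) (δ≤⇒≐ q))
    }

  []-unique-≐ : ∀ {A B X} {f : Hom A X} {g : Hom B X} {h : Hom (A +ₒ B) X} →
                h ∘ ι₁ ≐ f → h ∘ ι₂ ≐ g → h ≐ [ f , g ]
  []-unique-≐ {A} {B} {X} {f} {g} {h} p q =
    re-Holds identityʳ (Holds-+ (Holds-re (pair∘ γ₁) p) (Holds-re (pair∘ γ₂) q))
    where
    pair∘ : ∀ {Y} {ι : Hom Y (A +ₒ B)} {k : Hom Y X} →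
            [ f , g ] ∘ ι ≈ k → ⟨ h , [ f , g ] ⟩ ∘ ι ≈ ⟨ h ∘ ι , k ⟩
    pair∘ γ = ≈-trans ⟨⟩∘ (⟨⟩-cong₂ ≈-refl γ)

  X-coproducts : Coproducts XCat
  X-coproducts = record
    { 𝟘        = Co.𝟘
    ; ¡        = ⟦ Co.¡ ⟧
    ; ¡-unique = λ f → ≈⇒δ≤ (Co.¡-unique (proj₁ f))
    ; _+ₒ_     = _+ₒ_
    ; ι₁       = ⟦ ι₁ ⟧
    ; ι₂       = ⟦ ι₂ ⟧
    ; [_,_]    = λ f g → ⟦ [ proj₁ f , proj₁ g ] ⟧
    ; γ₁       = ≈⇒δ≤ γ₁
    ; γ₂       = ≈⇒δ≤ γ₂
    ; unique   = λ p q → ≐⇒δ≤ ([]-unique-≐ (δ≤⇒≐ p) (δ≤⇒≐ q))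
    }

  X-distributive : Distributive XCat X-products X-coproducts
  X-distributive = ⟦ proj₁ distributive ⟧ , ≈⇒δ≤ (proj₁ (proj₂ distributive))
                                           , ≈⇒δ≤ (proj₂ (proj₂ distributive))

  X-elementary : Elementary X-products XPred
  X-elementary = record { δ = δ ; adj = adj }

  X-existential : Existential X-products XPred
  X-existential = record
    { ∃₁ = ∃₁ ; adj₁ = adj₁ ; BC₁ = λ f → BC₁ (proj₁ f) ; Frob₁ = Frob₁
    ; ∃₂ = ∃₂ ; adj₂ = adj₂ ; BC₂ = λ f → BC₂ (proj₁ f) ; Frob₂ = Frob₂
    }
    where open Existential existential

  X-classifier : WeakPredicateClassifier X-products XPred
  X-classifier = record
    { Ω        = Ω
    ; ∈        = ∈
    ; classify = λ φ → ⟦ proj₁ (classify φ) ⟧ , proj₂ (classify φ)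
    }
    where open WeakPredicateClassifier classifier

  X-comprehension : FullWeakComprehension X-products XPred
  X-comprehension = record
    { cObj   = cObj
    ; cArr   = λ α → ⟦ cArr α ⟧
    ; c-top  = c-top
    ; c-fact = λ α f p → let (h , ch≈f) = c-fact α (proj₁ f) p in ⟦ h ⟧ , ≈⇒δ≤ ch≈f
    ; c-full = c-full
    }

  collapse-weakPullback : ∀ {X Y I W} (f : XHom X I) (g : XHom Y I) {p : Hom W X} {q : Hom W Y} →
                          Is≐-WeakPullback (proj₁ f) (proj₁ g) p q →
                          IsWeakPullback XCat f g ⟦ p ⟧ ⟦ q ⟧
  collapse-weakPullback f g w = record
    { commutes = ≐⇒δ≤ commutes
    ; factor   = λ a b p →
        let (h , ph≈a , qh≈b) = factor (proj₁ a) (proj₁ b) (δ≤⇒≐ p) in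
        ⟦ h ⟧ , ≈⇒δ≤ ph≈a , ≈⇒δ≤ qh≈b
    }
    where open Is≐-WeakPullback w

  X-weakPullbacks : HasWeakPullbacks XCat
  X-weakPullbacks f g = record
    { obj = obj ; p₁ = ⟦ p₁ ⟧ ; p₂ = ⟦ p₂ ⟧ ; isWPB = collapse-weakPullback f g isWPB }
    where open ≐-WeakPullback (≐-weakPullback (proj₁ f) (proj₁ g))

  -- The weak exponential of C between the saturations x̃ and ỹ serves for x and y.
  X-sliceWeakExp : ∀ {X Y I} (x : XHom X I) (y : XHom Y I) → SliceWeakExp XCat x y
  X-sliceWeakExp {Y = Y} {I} x y = record
    { W        = W
    ; w        = ⟦ w ⟧
    ; S        = S′
    ; ev       = ⟦ Sy.q ∘ ev ⟧
    ; ev-slice = ≐⇒δ≤ ev-slice′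
    ; curry    = curry′
    }
    where
    x₀ = proj₁ x
    y₀ = proj₁ y
    module Sx = Saturation (saturation x₀)
    module Sy = Saturation (saturation y₀)
    open SliceWeakExp (proj₂ sliceWCC Sx.x̃ Sy.x̃)
    open WeakPullback S using () renaming (p₁ to s₁; p₂ to s₂)

    S′ : WeakPullback XCat x ⟦ w ⟧
    S′ = record
      { obj   = WeakPullback.obj S
      ; p₁    = ⟦ Sx.q ∘ s₁ ⟧
      ; p₂    = ⟦ s₂ ⟧
      ; isWPB = collapse-weakPullback x ⟦ w ⟧ (saturation-paste (saturation x₀) (WeakPullback.isWPB S))
      }

    ev-slice′ : y₀ ∘ (Sy.q ∘ ev) ≐ x₀ ∘ (Sx.q ∘ s₁)
    ev-slice′ = begin
      y₀ ∘ (Sy.q ∘ ev)   ≈⟨ ≈-sym assoc ⟩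
      (y₀ ∘ Sy.q) ∘ ev   ≐⟨ ≐-precomp ev Sy.x∘q≐x̃ ⟩
      Sy.x̃ ∘ ev          ≈⟨ ev-slice ⟩
      Sx.x̃ ∘ s₁          ≐⟨ ≐-sym (≐-precomp s₁ Sx.x∘q≐x̃) ⟩
      (x₀ ∘ Sx.q) ∘ s₁   ≈⟨ assoc ⟩
      x₀ ∘ (Sx.q ∘ s₁)   ∎
      where open ≐-Reasoning

    curry′ : ∀ {D} (c : XHom D I) (T : WeakPullback XCat x c) (k : XHom (WeakPullback.obj T) Y) →
             X≈ (X∘ y k) (X∘ x (WeakPullback.p₁ T)) →
             Σ (XHom D W) λ k′ → X≈ (X∘ ⟦ w ⟧ k′) c ×
               Σ (XHom (WeakPullback.obj T) (WeakPullback.obj S)) λ h →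
                 X≈ (X∘ ⟦ Sx.q ∘ s₁ ⟧ h) (WeakPullback.p₁ T) ×
                 X≈ (X∘ ⟦ s₂ ⟧ h) (X∘ k′ (WeakPullback.p₂ T)) ×
                 X≈ (X∘ ⟦ Sy.q ∘ ev ⟧ h) k
    curry′ (c , _) T (k , _) yk≈xt₁ =
      let (k′ , wk′≈c , h , s₁h≈z₁ , s₂h≈k′z₂ , evh≈k″) = curry c Z k″ ỹ∘k″≈x̃∘z₁ in
      ⟦ k′ ⟧ , ≈⇒δ≤ wk′≈c , ⟦ h ∘ ι₂ ⟧
      , ≈⇒δ≤ (≈-trans assoc (≈-trans (∘-resp-≈ʳ (∘ι₂-factor s₁h≈z₁)) (proj₁ (proj₂ n-lift))))
      , ≈⇒δ≤ (∘ι₂-factor (≈-trans s₂h≈k′z₂ ∘[]))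
      , ≈⇒δ≤ (≈-trans assoc (≈-trans (∘-resp-≈ʳ (∘ι₂-factor evh≈k″)) (proj₁ (proj₂ kT-lift))))
      where
      open WeakPullback T renaming (obj to T₀)
      t₁ = proj₁ p₁
      t₂ = proj₁ p₂
      open IsWeakPullback isWPB renaming (commutes to T-commutes; factor to T-factor)

      y∘k≐x∘t₁ : y₀ ∘ k ≐ x₀ ∘ t₁
      y∘k≐x∘t₁ = δ≤⇒≐ yk≈xt₁

      n-lift : Σ (Hom T₀ Sx.obj) λ n → (Sx.q ∘ n ≈ t₁) × (Sx.x̃ ∘ n ≈ c ∘ t₂)
      n-lift = Sx.lift t₁ (c ∘ t₂) (δ≤⇒≐ T-commutes)
      n = proj₁ n-lift

      -- T is a weak pullback only up to ≐, so it is adjoined to a strict one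
      -- V as a coproduct summand.
      V = weakPullbacks Sx.x̃ c
      open WeakPullback V using () renaming (obj to V₀; p₁ to u₁; p₂ to u₂)

      Z : WeakPullback C Sx.x̃ c
      Z = record
        { obj   = V₀ +ₒ T₀
        ; p₁    = [ u₁ , n ]
        ; p₂    = [ u₂ , t₂ ]
        ; isWPB = +-weakPullback (WeakPullback.isWPB V) (proj₂ (proj₂ n-lift))
        }

      V-to-T : Σ (XHom V₀ T₀) λ g → X≈ (X∘ p₁ g) ⟦ Sx.q ∘ u₁ ⟧ × X≈ (X∘ p₂ g) ⟦ u₂ ⟧
      V-to-T = T-factor ⟦ Sx.q ∘ u₁ ⟧ ⟦ u₂ ⟧
                 (≐⇒δ≤ (Is≐-WeakPullback.commutes
                         (saturation-paste (saturation x₀) (WeakPullback.isWPB V))))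
      g = proj₁ (proj₁ V-to-T)

      kV-lift : Σ (Hom V₀ Sy.obj) λ m → (Sy.q ∘ m ≈ k ∘ g) × (Sy.x̃ ∘ m ≈ Sx.x̃ ∘ u₁)
      kV-lift = Sy.lift (k ∘ g) (Sx.x̃ ∘ u₁) (begin
        y₀ ∘ (k ∘ g)        ≈⟨ ≈-sym assoc ⟩
        (y₀ ∘ k) ∘ g        ≐⟨ ≐-precomp g y∘k≐x∘t₁ ⟩
        (x₀ ∘ t₁) ∘ g       ≈⟨ assoc ⟩
        x₀ ∘ (t₁ ∘ g)       ≐⟨ ≐-postcomp x₀ (δ≤⇒≐ (proj₁ (proj₂ V-to-T))) ⟩
        x₀ ∘ (Sx.q ∘ u₁)    ≈⟨ ≈-sym assoc ⟩
        (x₀ ∘ Sx.q) ∘ u₁    ≐⟨ ≐-precomp u₁ Sx.x∘q≐x̃ ⟩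
        Sx.x̃ ∘ u₁           ∎)
        where open ≐-Reasoning

      kT-lift : Σ (Hom T₀ Sy.obj) λ m → (Sy.q ∘ m ≈ k) × (Sy.x̃ ∘ m ≈ Sx.x̃ ∘ n)
      kT-lift = Sy.lift k (Sx.x̃ ∘ n) (begin
        y₀ ∘ k              ≐⟨ y∘k≐x∘t₁ ⟩
        x₀ ∘ t₁             ≈⟨ ∘-resp-≈ʳ (≈-sym (proj₁ (proj₂ n-lift))) ⟩
        x₀ ∘ (Sx.q ∘ n)     ≈⟨ ≈-sym assoc ⟩
        (x₀ ∘ Sx.q) ∘ n     ≐⟨ ≐-precomp n Sx.x∘q≐x̃ ⟩
        Sx.x̃ ∘ n            ∎)
        where open ≐-Reasoning

      k″ : Hom (V₀ +ₒ T₀) Sy.obj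
      k″ = [ proj₁ kV-lift , proj₁ kT-lift ]

      ỹ∘k″≈x̃∘z₁ : Sy.x̃ ∘ k″ ≈ Sx.x̃ ∘ [ u₁ , n ]
      ỹ∘k″≈x̃∘z₁ = ≈-trans ∘[] (≈-trans ([]-cong₂ (proj₂ (proj₂ kV-lift)) (proj₂ (proj₂ kT-lift)))
                                       (≈-sym ∘[]))

  X-intensionalHyperTripos : IntensionalHyperTripos X-products XPred
  X-intensionalHyperTripos = record
    { elementary    = X-elementary
    ; existential   = X-existential
    ; classifier    = X-classifier
    ; comprehension = X-comprehension
    ; weakPullbacks = X-weakPullbacks
    ; sliceWCC      = X-weakPullbacks , X-sliceWeakExp
    ; coproducts    = X-coproducts
    ; distributive  = X-distributive
    }

  X-hyperTripos : HyperTripos X-products XPred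
  X-hyperTripos = record
    { intensional = X-intensionalHyperTripos
    ; compDiag    = λ f g → mk⇔ (λ f≈g → δ≤⇒≐ f≈g , ⊤-max) (λ ⊤≈δ → ≐⇒δ≤ (proj₁ ⊤≈δ))
    }

proposition8p13 :
    ∀ {ℓ} (C : CatData ℓ) (Pr : Products C) (Pd : PredData C)
      (isD : IsDoctrine C Pd) (H : IntensionalHyperTripos Pr Pd) →
      Σ (Products (Collapse.XCat C Pr Pd isD
                     (Elementary.δ (IntensionalHyperTripos.elementary H))))
        λ Pr' →
          IsDoctrine (Collapse.XCat C Pr Pd isD
                        (Elementary.δ (IntensionalHyperTripos.elementary H)))
                     (Collapse.XPred C Pr Pd isD
                        (Elementary.δ (IntensionalHyperTripos.elementary H)))
          × HyperTripos Pr' (Collapse.XPred C Pr Pd isD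
                        (Elementary.δ (IntensionalHyperTripos.elementary H)))
proposition8p13 C Pr Pd isD H = X-products , X-isDoctrine , X-hyperTripos
  where open Collapsed C Pr Pd isD H
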